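{- Let $G=(V,E)$ be a connected unweighted graph on $n$ vertices with shortest-path metric $\delta$, accessed through a distance oracle, and let $f$ be a sublinear function of $n$. The randomized algorithm $\textsc{Approx-Reconstruction}(V)$ described in the context computes an $f$-approximation $\widehat{\delta}$ of $\delta$, using an expected number of $O(n^2(\log n)/f)$ queries.
   Context: Query model: $V$ is given and $\delta$ is accessible only via an oracle returning $\delta(u,v)$ for a queried pair; cost is the number of queries. A function $\widehat{\delta}$ on pairs is an $f$-approximation of $\delta$ if $\widehat{\delta}(u,v)\leq\delta(u,v)\leq f\cdot\widehat{\delta}(u,v)$ for every pair $(u,v)$ of distinct vertices. Algorithm $\textsc{Approx-Reconstruction}(V)$: while $\widehat{\delta}$ is not defined on every pair of nodes: choose $u\in V$ uniformly at random; query $(u,v)$ for every $v\in V$ and set $\widehat{\delta}(u,v)=\delta(u,v)$; let $S_u=\{v:\delta(u,v)<f/2\}$; for every $v\in S_u\setminus\{u\}$, set $\widehat{\delta}(v,w)=1$ for every $w\in S_u\setminus\{v\}$ and $\widehat{\delta}(v,w)=\delta(u,w)-\delta(u,v)$ for every $w\notin S_u$. Return $\widehat{\delta}$. -}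

module Defs where

open import Data.Nat using (ℕ; zero; suc; _+_; _*_; _∸_; _^_; _≤_; _<_; NonZero)
open import Data.Nat.Properties using (_<?_; m^n≢0)
open import Data.Nat.Logarithm using (⌊log₂_⌋)
open import Data.Fin using (Fin; _≟_)
open import Data.List using (List; []; _∷_; map; sum; all; inits; take; length; allFin)
open import Data.Bool using (Bool; true; false; if_then_else_; not; _∨_)
open import Data.Maybe using (Maybe; just; nothing; is-just; _<∣>_)
open import Data.Product using (Σ; _×_; ∃)
open import Data.Integer using (+_)
open import Data.Rational using (ℚ; _/_; 0ℚ) renaming (_+_ to _+ℚ_; _*_ to _*ℚ_)
open import Relation.Nullary using (¬_; does)
open import Relation.Binary.PropositionalEquality using (_≡_; _≢_)

record Graph (n : ℕ) : Set₁ where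
  field
    Adj     : Fin n → Fin n → Set
    symAdj  : ∀ {u v} → Adj u v → Adj v u
    irrefl  : ∀ {u} → ¬ Adj u u

data Walk {n : ℕ} (G : Graph n) : Fin n → Fin n → ℕ → Set where
  here : ∀ {u} → Walk G u u 0
  step : ∀ {u w v k} → Graph.Adj G u w → Walk G w v k → Walk G u v (suc k)

Connected : ∀ {n} → Graph n → Set
Connected {n} G = ∀ (u v : Fin n) → ∃ λ k → Walk G u v k

IsShortestPathMetric : ∀ {n} → Graph n → (Fin n → Fin n → ℕ) → Set
IsShortestPathMetric {n} G δ =
  ∀ (u v : Fin n) → Walk G u v (δ u v) × (∀ k → Walk G u v k → δ u v ≤ k)

-- The algorithm Approx-Reconstruction, parameterised by the (integer)
-- approximation factor f and the oracle δ.
-- A partial estimate on ordered pairs: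

Est : ℕ → Set
Est n = Fin n → Fin n → Maybe ℕ

-- v ∈ S_u  iff  δ(u,v) < f/2  iff  2·δ(u,v) < f
inBall : ∀ {n} → ℕ → (Fin n → Fin n → ℕ) → Fin n → Fin n → Bool
inBall f δ u v = does (2 * δ u v <? f)

-- the assignments made in one iteration with chosen centre u
-- (nothing = not assigned in this iteration)
iter : ∀ {n} → ℕ → (Fin n → Fin n → ℕ) → Fin n → Est n
iter f δ u x y =
  if does (x ≟ u) then just (δ u y)
  else if inBall f δ u x
       then (if inBall f δ u y then just 1 else just (δ u y ∸ δ u x))
       else nothing

-- run of the algorithm on a chronological list of chosen centres;
-- later assignments override earlier ones
run : ∀ {n} → ℕ → (Fin n → Fin n → ℕ) → List (Fin n) → Est n
run f δ []       x y = nothing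
run f δ (u ∷ s) x y = run f δ s x y <∣> iter f δ u x y

isDone : ∀ {n} → Est n → Bool
isDone {n} e =
  all (λ x → all (λ y → does (x ≟ y) ∨ is-just (e x y)) (allFin n)) (allFin n)

Stops : ∀ {n} → ℕ → (Fin n → Fin n → ℕ) → List (Fin n) → Set
Stops f δ s = isDone (run f δ s) ≡ true
            × (∀ i → i < length s → isDone (run f δ (take i s)) ≡ false)

IsApprox : ∀ {n} → ℕ → (Fin n → Fin n → ℕ) → Est n → Set
IsApprox {n} f δ e = ∀ (x y : Fin n) → x ≢ y →
  Σ ℕ λ d → e x y ≡ just d × d ≤ δ x y × δ x y ≤ f * d

-- Randomness: each iteration picks u uniformly from Fin n, independently.
-- The loop performs more than t iterations iff none of the first t
-- prefixes (lengths 0..t) of the choice sequence is done.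

continues : ∀ {n} → ℕ → (Fin n → Fin n → ℕ) → List (Fin n) → Bool
continues f δ s = all (λ p → not (isDone (run f δ p))) (inits s)

countSeqs : ∀ {n} → ℕ → (List (Fin n) → Bool) → ℕ
countSeqs zero    P = if P [] then 1 else 0
countSeqs {n} (suc t) P = sum (map (λ u → countSeqs t (λ s → P (u ∷ s))) (allFin n))

-- Pr[T > t] for n = suc m vertices
probMore : ∀ m → ℕ → (Fin (suc m) → Fin (suc m) → ℕ) → ℕ → ℚ
probMore m f δ t =
  _/_ (+ countSeqs t (continues f δ)) (suc m ^ t) {{m^n≢0 (suc m) t}}

-- partial sum  Σ_{t<k} n · Pr[T > t]  of  E[#queries] = n · E[T] = n · Σ_{t≥0} Pr[T>t]
-- (each iteration makes n queries (u,v), v ∈ V)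
partialExpectedQueries : ∀ m → ℕ → (Fin (suc m) → Fin (suc m) → ℕ) → ℕ → ℚ
partialExpectedQueries m f δ zero    = 0ℚ
partialExpectedQueries m f δ (suc k) =
  partialExpectedQueries m f δ k +ℚ ((+ suc m / 1) *ℚ probMore m f δ k)

-- f is sublinear: f(n)/n → 0
Sublinear : (ℕ → ℕ) → Set
Sublinear f = ∀ c → ∃ λ N → ∀ n → N ≤ n → suc c * f n ≤ n

module Submission where

-- Every value the algorithm writes is an f-approximation of δ: for
-- the centre u itself it is exact; for x, y ∈ S_u it is 1 ≤ δ(x,y) < f; for
-- x ∈ S_u, y ∉ S_u the triangle inequality gives δ(u,y) − δ(u,x) ≤ δ(x,y) ≤
-- 2δ(u,x) + (δ(u,y) − δ(u,x)) ≤ f·(δ(u,y) − δ(u,x)).  Once the stopping test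
-- passes, every pair carries such a value.
--
-- Let r be the radius with 2r < f ≤ 2r + 2 and b = r + 1.  A ball
-- of radius r in a shortest-path metric has at least b vertices, and each of them
-- is a centre whose S_u contains the ball's centre; so each vertex is missed by at
-- most a = n − b centres.  While the loop runs some vertex has been missed by
-- every centre, so by the union bound at most n·aᵗ of the nᵗ choice sequences
-- survive t rounds (and trivially at most nᵗ).  By Bernoulli's inequality these
-- survivor counts make the partial sums of E[#rounds] = Σ_t Pr[survive t] at most
-- T + n/b with T ≈ (n/b)·log n, which gives the bound 6·n²·⌊log₂ n⌋/f.

open import Defs
open import Data.Nat using (ℕ; suc; _*_; _≤_; NonZero)
open import Data.Nat.Logarithm using (⌊log₂_⌋)
open import Data.Fin using (Fin)
open import Data.List using (List)
open import Data.Product using (_×_; ∃)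
open import Data.Integer using (+_)
open import Data.Rational using (_/_) renaming (_≤_ to _≤ℚ_)

open import Data.Nat using (zero; _+_; _∸_; _^_; _<_; _≤ᵇ_; z≤n; s≤s; _≤?_; >-nonZero; >-nonZero⁻¹)
open import Data.Nat.Properties hiding (_≟_)
open import Data.Nat.Tactic.RingSolver using (solve-∀)
open import Data.Nat.ListAction using (sum)
open import Data.Nat.Logarithm using (⌊log₂⌋-mono-≤; ⌊log₂[2^n]⌋≡n)
open import Data.Nat.DivMod using (_%_; m≡m%n+[m/n]*n; m%n<n; m/n*n≤m) renaming (_/_ to _div_)
open import Data.Integer using (ℤ)
import Data.Integer as ℤ
import Data.Integer.Properties as ℤP
open import Data.Rational using (ℚ)
import Data.Rational as ℚ
import Data.Rational.Properties as ℚP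
open import Data.Rational.Unnormalised using (ℚᵘ; mkℚᵘ)
import Data.Rational.Unnormalised as ℚᵘ
import Data.Rational.Unnormalised.Properties as ℚᵘP
open import Data.Fin using (_≟_)
open import Data.Fin.Properties using (any?)
open import Data.Bool using (Bool; true; false; T; if_then_else_; not; _∨_; _∧_)
open import Data.Bool.ListAction using (all; any)
open import Data.Maybe using (Maybe; just; nothing; is-just)
open import Data.List using ([]; _∷_; map; length; allFin; inits)
open import Data.List.Properties using (length-tabulate; map-cong)
open import Data.List.Membership.Propositional using (_∈_; lose)
open import Data.List.Membership.Propositional.Properties using (∈-allFin; ∈-map⁺)
import Data.List.Relation.Unary.All as All
open import Data.List.Relation.Unary.All.Properties using (all⁺; all⁻; ¬All⇒Any¬)
open import Data.List.Relation.Unary.Any using (satisfied; here; there)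
open import Data.List.Relation.Unary.Any.Properties using (any⁺)
open import Data.Product using (_,_; proj₁; proj₂)
open import Data.Sum using (_⊎_; inj₁; inj₂)
open import Data.Unit using (tt)
open import Data.Empty using (⊥-elim)
open import Function using (_∘_; id)
open import Relation.Nullary using (¬_; yes; no)
open import Relation.Nullary.Decidable using (T?)
open import Relation.Binary.PropositionalEquality

module Walks {n : ℕ} (G : Graph n) where
  open Graph G

  walk-append : ∀ {u w v k l} → Walk G u w k → Walk G w v l → Walk G u v (k + l)
  walk-append here       q = q
  walk-append (step a p) q = step a (walk-append p q)

  walk-reverse : ∀ {u v k} → Walk G u v k → Walk G v u k
  walk-reverse here = here
  walk-reverse {k = suc k} (step a p) =
    subst (Walk G _ _) (+-comm k 1) (walk-append (walk-reverse p) (step (symAdj a) here))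

  walk-split : ∀ {u v} d e → Walk G u v (d + e) → ∃ λ w → Walk G u w d × Walk G w v e
  walk-split zero    e p          = _ , here , p
  walk-split (suc d) e (step a p) with walk-split d e p
  ... | w , p₁ , p₂ = w , step a p₁ , p₂

module ShortestPath {n : ℕ} (G : Graph n) (δ : Fin n → Fin n → ℕ)
                    (sp : IsShortestPathMetric G δ) where
  open Walks G

  geodesic : ∀ u v → Walk G u v (δ u v)
  geodesic u v = proj₁ (sp u v)

  shortest : ∀ {u v k} → Walk G u v k → δ u v ≤ k
  shortest {u} {v} = proj₂ (sp u v) _

  δ-sym : ∀ u v → δ u v ≡ δ v u
  δ-sym u v = ≤-antisym (shortest (walk-reverse (geodesic v u)))
                        (shortest (walk-reverse (geodesic u v)))

  δ-triangle : ∀ u w v → δ u v ≤ δ u w + δ w v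
  δ-triangle u w v = shortest (walk-append (geodesic u w) (geodesic w v))

  δ-self : ∀ u → δ u u ≡ 0
  δ-self u = n≤0⇒n≡0 (shortest {u} here)

  δ-positive : ∀ u v → u ≢ v → 1 ≤ δ u v
  δ-positive u v u≢v with δ u v | geodesic u v
  ... | zero  | here = ⊥-elim (u≢v refl)
  ... | suc _ | _    = s≤s z≤n

  -- Along a geodesic every intermediate distance is realised: either some
  -- vertex lies at distance exactly d from x, or all vertices are closer.
  sphere-or-all-closer : ∀ x d → (∃ λ w → δ x w ≡ d) ⊎ (∀ v → δ x v < d)
  sphere-or-all-closer x d with any? (λ v → d ≤? δ x v)
  ... | no  none-far          = inj₂ (λ v → ≰⇒> (λ d≤ → none-far (v , d≤)))
  ... | yes (v , d≤δxv) with walk-split d (δ x v ∸ d)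
                               (subst (Walk G x v) (sym (m+[n∸m]≡n d≤δxv)) (geodesic x v))
  ...   | w , x⇝w , w⇝v = inj₁ (w , ≤-antisym (shortest x⇝w) d≤δxw)
    where
    d≤δxw : d ≤ δ x w
    d≤δxw = +-cancelʳ-≤ (δ x v ∸ d) d (δ x w) (begin
      d + (δ x v ∸ d)         ≡⟨ m+[n∸m]≡n d≤δxv ⟩
      δ x v                   ≤⟨ δ-triangle x w v ⟩
      δ x w + δ w v           ≤⟨ +-monoʳ-≤ (δ x w) (shortest w⇝v) ⟩
      δ x w + (δ x v ∸ d)     ∎)
      where open ≤-Reasoning

Approximates : ∀ {n} → ℕ → (Fin n → Fin n → ℕ) → Fin n → Fin n → ℕ → Set
Approximates f δ x y d = d ≤ δ x y × δ x y ≤ f * d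

-- Arithmetic behind the estimate for a pair straddling the ball: with the
-- centre at distance a < f/2 from x, the true distance is at most 2a + e.
straddle-bound : ∀ {f} a e → 2 * a < f → 1 ≤ e → a + (a + e) ≤ f * e
straddle-bound {f} a (suc e) 2a<f _ = begin
  a + (a + suc e)   ≡⟨ rearrange a e ⟩
  suc (2 * a) + e   ≤⟨ +-mono-≤ 2a<f (m≤n*m e f {{>-nonZero (≤-<-trans z≤n 2a<f)}}) ⟩
  f + f * e         ≡⟨ *-suc f e ⟨
  f * suc e         ∎
  where
  open ≤-Reasoning
  rearrange : ∀ a e → a + (a + suc e) ≡ suc (2 * a) + e
  rearrange = solve-∀

halves-sum : ∀ {f} a b → 2 * a < f → 2 * b < f → a + b < f
halves-sum {f} a b 2a<f 2b<f = *-cancelˡ-< 2 (a + b) f (begin-strict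
  2 * (a + b)   ≡⟨ *-distribˡ-+ 2 a b ⟩
  2 * a + 2 * b <⟨ +-mono-< 2a<f 2b<f ⟩
  f + f         ≡⟨ cong (_+_ f) (+-identityʳ f) ⟨
  2 * f         ∎)
  where open ≤-Reasoning

all-true-at : ∀ {A : Set} (p : A → Bool) {xs x} → T (all p xs) → x ∈ xs → T (p x)
all-true-at p {xs} h x∈xs = All.lookup (all⁺ p xs h) x∈xs

all-false-witness : ∀ {A : Set} (p : A → Bool) xs → ¬ T (all p xs) → ∃ λ x → ¬ T (p x)
all-false-witness p xs h = satisfied (¬All⇒Any¬ (T? ∘ p) xs (h ∘ all⁻ p))

ball-member : ∀ {n} f δ (u v : Fin n) → inBall f δ u v ≡ true → 2 * δ u v < f
ball-member f δ u v eq = <ᵇ⇒< (2 * δ u v) f (subst T (sym eq) tt)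

ball-nonmember : ∀ {n} f δ (u v : Fin n) → inBall f δ u v ≡ false → f ≤ 2 * δ u v
ball-nonmember f δ u v eq = ≮⇒≥ (λ lt → subst T eq (<⇒<ᵇ lt))

module IterationSoundness {n : ℕ} (G : Graph n) (δ : Fin n → Fin n → ℕ)
                          (sp : IsShortestPathMetric G δ) (f : ℕ) (f≥1 : 1 ≤ f) where
  open ShortestPath G δ sp

  centre-estimate : ∀ u y → Approximates f δ u y (δ u y)
  centre-estimate u y = ≤-refl , m≤n*m (δ u y) f {{>-nonZero f≥1}}

  -- x, y ∈ S_u: estimate 1, since δ(x,y) ≤ δ(x,u) + δ(u,y) < f
  inside-estimate : ∀ u x y → x ≢ y → 2 * δ u x < f → 2 * δ u y < f → Approximates f δ x y 1
  inside-estimate u x y x≢y x∈S y∈S = δ-positive x y x≢y , (begin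
    δ x y         ≤⟨ δ-triangle x u y ⟩
    δ x u + δ u y ≡⟨ cong (_+ δ u y) (δ-sym x u) ⟩
    δ u x + δ u y ≤⟨ <⇒≤ (halves-sum (δ u x) (δ u y) x∈S y∈S) ⟩
    f             ≡⟨ *-identityʳ f ⟨
    f * 1         ∎)
    where open ≤-Reasoning

  outside-estimate : ∀ u x y → 2 * δ u x < f → f ≤ 2 * δ u y →
                     Approximates f δ x y (δ u y ∸ δ u x)
  outside-estimate u x y x∈S y∉S = lower , upper
    where
    open ≤-Reasoning
    e = δ u y ∸ δ u x
    ux<uy : δ u x < δ u y
    ux<uy = *-cancelˡ-< 2 (δ u x) (δ u y) (<-≤-trans x∈S y∉S)
    lower : e ≤ δ x y
    lower = begin
      δ u y ∸ δ u x           ≤⟨ ∸-monoˡ-≤ (δ u x) (δ-triangle u x y) ⟩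
      δ u x + δ x y ∸ δ u x   ≡⟨ m+n∸m≡n (δ u x) (δ x y) ⟩
      δ x y                   ∎
    upper : δ x y ≤ f * e
    upper = begin
      δ x y                   ≤⟨ δ-triangle x u y ⟩
      δ x u + δ u y           ≡⟨ cong₂ _+_ (δ-sym u x) (m+[n∸m]≡n (<⇒≤ ux<uy)) ⟨
      δ u x + (δ u x + e)     ≤⟨ straddle-bound (δ u x) e x∈S (m<n⇒0<n∸m ux<uy) ⟩
      f * e                   ∎

  -- (a vertex x ≠ u outside S_u receives no value in this iteration)
  iteration-sound : ∀ u x y {d} → x ≢ y → iter f δ u x y ≡ just d → Approximates f δ x y d
  iteration-sound u x y x≢y eq with x ≟ u | inBall f δ u x in x∈? | inBall f δ u y in y∈?
  iteration-sound u .u y x≢y refl | yes refl | _ | _ = centre-estimate u y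
  iteration-sound u x y x≢y refl | no _ | true | true =
    inside-estimate u x y x≢y (ball-member f δ u x x∈?) (ball-member f δ u y y∈?)
  iteration-sound u x y x≢y refl | no _ | true | false =
    outside-estimate u x y (ball-member f δ u x x∈?) (ball-nonmember f δ u y y∈?)

run-origin : ∀ {n} f δ (s : List (Fin n)) x y {d} → run f δ s x y ≡ just d →
             ∃ λ u → iter f δ u x y ≡ just d
run-origin f δ []      x y ()
run-origin f δ (u ∷ s) x y eq with run f δ s x y in earlier
... | just _  = run-origin f δ s x y (trans earlier eq)
... | nothing = u , eq

done-defined : ∀ {n} (e : Est n) → T (isDone e) → ∀ x y → x ≢ y → ∃ λ d → e x y ≡ just d
done-defined {n} e done x y x≢y
  with all-true-at _ (all-true-at _ done (∈-allFin x)) (∈-allFin y)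
... | defined with x ≟ y | e x y
...   | yes x≡y | _      = ⊥-elim (x≢y x≡y)
...   | no _    | just d  = d , refl
...   | no _    | nothing = ⊥-elim defined

approximation-correct : ∀ {n} (G : Graph n) (δ : Fin n → Fin n → ℕ) →
  IsShortestPathMetric G δ → (f : ℕ) → 1 ≤ f → (s : List (Fin n)) →
  T (isDone (run f δ s)) → IsApprox f δ (run f δ s)
approximation-correct G δ sp f f≥1 s done x y x≢y
  with done-defined (run f δ s) done x y x≢y
... | d , written with run-origin f δ s x y written
...   | u , by-u = d , written , iteration-sound u x y x≢y by-u
  where open IterationSoundness G δ sp f f≥1

module _ {A : Set} where
  sum-map-mono : ∀ {g h : A → ℕ} → (∀ x → g x ≤ h x) → ∀ xs → sum (map g xs) ≤ sum (map h xs)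
  sum-map-mono g≤h []       = z≤n
  sum-map-mono g≤h (x ∷ xs) = +-mono-≤ (g≤h x) (sum-map-mono g≤h xs)

  sum-map-mono-< : ∀ {g h : A → ℕ} → (∀ x → g x ≤ h x) → ∀ {y xs} → y ∈ xs → g y < h y →
                   sum (map g xs) < sum (map h xs)
  sum-map-mono-< g≤h {xs = _ ∷ xs} (here refl) gy<hy = +-mono-<-≤ gy<hy (sum-map-mono g≤h xs)
  sum-map-mono-< g≤h {xs = x ∷ _}  (there y∈)  gy<hy = +-mono-≤-< (g≤h x) (sum-map-mono-< g≤h y∈ gy<hy)

  sum-map-+ : ∀ (g h : A → ℕ) xs → sum (map (λ x → g x + h x) xs) ≡ sum (map g xs) + sum (map h xs)
  sum-map-+ g h []       = refl
  sum-map-+ g h (x ∷ xs) rewrite sum-map-+ g h xs = interchange (g x) (h x) _ _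
    where
    interchange : ∀ a b c d → a + b + (c + d) ≡ a + c + (b + d)
    interchange = solve-∀

  sum-map-*ʳ : ∀ (g : A → ℕ) c xs → sum (map (λ x → g x * c) xs) ≡ sum (map g xs) * c
  sum-map-*ʳ g c []       = refl
  sum-map-*ʳ g c (x ∷ xs) rewrite sum-map-*ʳ g c xs = sym (*-distribʳ-+ c (g x) (sum (map g xs)))

  sum-map-const : ∀ c (xs : List A) → sum (map (λ _ → c) xs) ≡ length xs * c
  sum-map-const c []       = refl
  sum-map-const c (x ∷ xs) = cong (_+_ c) (sum-map-const c xs)

Σᵥ : ∀ {n} → (Fin n → ℕ) → ℕ
Σᵥ {n} g = sum (map g (allFin n))

Σᵥ-const : ∀ n c → Σᵥ {n} (λ _ → c) ≡ n * c
Σᵥ-const n c = trans (sum-map-const c (allFin n)) (cong (_* c) (length-tabulate {n = n} id))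

indicator : Bool → ℕ
indicator b = if b then 1 else 0

indicator-mono : ∀ {a b} → (T a → T b) → indicator a ≤ indicator b
indicator-mono {false} _   = z≤n
indicator-mono {true} {true}  _   = ≤-refl
indicator-mono {true} {false} a⇒b = ⊥-elim (a⇒b tt)

count : ∀ {n} → (Fin n → Bool) → ℕ
count P = Σᵥ (indicator ∘ P)

indicator-strict : ∀ {a b} → ¬ T a → T b → indicator a < indicator b
indicator-strict {false} {true} _ _ = s≤s z≤n
indicator-strict {true}         ¬a _ = ⊥-elim (¬a tt)

indicator-∨ : ∀ a b → indicator (a ∨ b) ≤ indicator a + indicator b
indicator-∨ false b = ≤-refl
indicator-∨ true  b = m≤m+n 1 (indicator b)

indicator-complement : ∀ b → indicator b + indicator (not b) ≡ 1
indicator-complement false = refl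
indicator-complement true  = refl

module _ {n : ℕ} where
  count-mono : ∀ {P Q : Fin n → Bool} → (∀ u → T (P u) → T (Q u)) → count P ≤ count Q
  count-mono P⇒Q = sum-map-mono (λ u → indicator-mono (P⇒Q u)) (allFin n)

  count-strict : ∀ {P Q : Fin n → Bool} → (∀ u → T (P u) → T (Q u)) →
                 ∀ w → ¬ T (P w) → T (Q w) → count P < count Q
  count-strict P⇒Q w ¬Pw Qw =
    sum-map-mono-< (λ u → indicator-mono (P⇒Q u)) (∈-allFin w) (indicator-strict ¬Pw Qw)

  count-all : ∀ {P : Fin n → Bool} → (∀ u → T (P u)) → n ≤ count P
  count-all {P} all-P = begin
    n                        ≡⟨ *-identityʳ n ⟨
    n * 1                    ≡⟨ Σᵥ-const n 1 ⟨
    count {n} (λ _ → true)   ≤⟨ count-mono (λ u _ → all-P u) ⟩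
    count P                  ∎
    where open ≤-Reasoning

  count-complement : ∀ (P : Fin n → Bool) → count P + count (not ∘ P) ≡ n
  count-complement P = begin
    count P + count (not ∘ P)                                  ≡⟨ sum-map-+ (indicator ∘ P) (indicator ∘ not ∘ P) (allFin n) ⟨
    Σᵥ (λ u → indicator (P u) + indicator (not (P u)))         ≡⟨ cong sum (map-cong (indicator-complement ∘ P) (allFin n)) ⟩
    Σᵥ {n} (λ _ → 1)                                           ≡⟨ Σᵥ-const n 1 ⟩
    n * 1                                                      ≡⟨ *-identityʳ n ⟩
    n                                                          ∎
    where open ≡-Reasoning

-- Counting choice sequences: countSeqs t P is the number of s ∈ Vᵗ with P s,
-- i.e. nᵗ · Pr[P] for t uniform independent choices.
module _ {n : ℕ} where
  countSeqs-mono : ∀ t {P Q : List (Fin n) → Bool} → (∀ s → T (P s) → T (Q s)) →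
                   countSeqs t P ≤ countSeqs t Q
  countSeqs-mono zero    P⇒Q = indicator-mono (P⇒Q [])
  countSeqs-mono (suc t) P⇒Q = sum-map-mono (λ u → countSeqs-mono t (λ s → P⇒Q (u ∷ s))) (allFin n)

  countSeqs-never : ∀ t → countSeqs {n} t (λ _ → false) ≡ 0
  countSeqs-never zero    = refl
  countSeqs-never (suc t) = begin
    Σᵥ {n} (λ _ → countSeqs {n} t (λ _ → false))≡⟨ cong sum (map-cong (λ _ → countSeqs-never t) (allFin n)) ⟩
    Σᵥ {n} (λ _ → 0)                      ≡⟨ Σᵥ-const n 0 ⟩
    n * 0                                 ≡⟨ *-zeroʳ n ⟩
    0                                     ∎
    where open ≡-Reasoning

  countSeqs-∨ : ∀ t (P Q : List (Fin n) → Bool) →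
                countSeqs t (λ s → P s ∨ Q s) ≤ countSeqs t P + countSeqs t Q
  countSeqs-∨ zero    P Q = indicator-∨ (P []) (Q [])
  countSeqs-∨ (suc t) P Q = ≤-trans (sum-map-mono (λ u → countSeqs-∨ t _ _) (allFin n))
                                    (≤-reflexive (sum-map-+ _ _ (allFin n)))

  countSeqs-any : ∀ t {A : Set} (Q : A → List (Fin n) → Bool) xs →
                  countSeqs t (λ s → any (λ x → Q x s) xs) ≤ sum (map (λ x → countSeqs t (Q x)) xs)
  countSeqs-any t Q []       = ≤-reflexive (countSeqs-never t)
  countSeqs-any t Q (x ∷ xs) = ≤-trans (countSeqs-∨ t (Q x) _) (+-monoʳ-≤ _ (countSeqs-any t Q xs))

  -- independence: t choices all landing in {u : g u} happen in at most (count g)ᵗ ways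
  countSeqs-all : ∀ t (g : Fin n → Bool) → countSeqs t (all g) ≤ count g ^ t
  countSeqs-all zero    g = ≤-refl
  countSeqs-all (suc t) g = begin
    Σᵥ (λ u → countSeqs t (λ s → g u ∧ all g s))  ≤⟨ sum-map-mono first-choice (allFin n) ⟩
    Σᵥ (λ u → indicator (g u) * count g ^ t)      ≡⟨ sum-map-*ʳ (indicator ∘ g) (count g ^ t) (allFin n) ⟩
    count g * count g ^ t                         ∎
    where
    open ≤-Reasoning
    first-choice : ∀ u → countSeqs t (λ s → g u ∧ all g s) ≤ indicator (g u) * count g ^ t
    first-choice u with g u
    ... | true  = ≤-trans (countSeqs-all t g) (m≤m+n (count g ^ t) 0)
    ... | false = ≤-reflexive (countSeqs-never t)

  countSeqs-total : ∀ t (P : List (Fin n) → Bool) → countSeqs t P ≤ n ^ t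
  countSeqs-total zero    P = indicator-mono {b = true} (λ _ → tt)
  countSeqs-total (suc t) P = ≤-trans (sum-map-mono (λ u → countSeqs-total t _) (allFin n))
                                      (≤-reflexive (Σᵥ-const n (n ^ t)))

avoided : ∀ {n} → ℕ → (Fin n → Fin n → ℕ) → Fin n → List (Fin n) → Bool
avoided f δ x = all (λ u → not (inBall f δ u x))

-- A pair (x, y) is still unassigned only if every centre so far avoided x:
-- a centre u with x ∈ S_u (in particular u = x) assigns every pair (x, ·).
unassigned-avoided : ∀ {n} f δ (s : List (Fin n)) x y → run f δ s x y ≡ nothing →
                     T (avoided f δ x s)
unassigned-avoided f δ []      x y _  = tt
unassigned-avoided f δ (u ∷ s) x y eq
  with run f δ s x y in earlier | x ≟ u | inBall f δ u x | inBall f δ u y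
... | nothing | no _ | false | _ = unassigned-avoided f δ s x y earlier
unassigned-avoided f δ (u ∷ s) x y () | nothing | no _ | true | true
unassigned-avoided f δ (u ∷ s) x y () | nothing | no _ | true | false

-- the loop tests the current estimate after every prefix, in particular after all of s
∈-inits : ∀ {A : Set} (s : List A) → s ∈ inits s
∈-inits []      = here refl
∈-inits (x ∷ s) = there (∈-map⁺ (x ∷_) (∈-inits s))

not-T : ∀ {b} → T (not b) → ¬ T b
not-T {false} _ ()

failed-pair-unassigned : ∀ {b} (m : Maybe ℕ) → ¬ T (b ∨ is-just m) → m ≡ nothing
failed-pair-unassigned         nothing  _ = refl
failed-pair-unassigned {false} (just _) h = ⊥-elim (h tt)
failed-pair-unassigned {true}  (just _) h = ⊥-elim (h tt)

running-avoided : ∀ {n} f δ (s : List (Fin n)) → T (continues f δ s) →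
                  T (any (λ x → avoided f δ x s) (allFin n))
running-avoided {n} f δ s running
  with all-false-witness _ (allFin n) (not-T (all-true-at _ running (∈-inits s)))
... | x , x-unfinished with all-false-witness _ (allFin n) x-unfinished
...   | y , xy-unassigned =
  any⁺ _ (lose (∈-allFin x) (unassigned-avoided f δ s x y (failed-pair-unassigned (run f δ s x y) xy-unassigned)))

-- Survival count: if every vertex is missed by at most a of the n possible
-- centres, at most n·aᵗ of the nᵗ choice sequences keep the loop running
-- for t rounds (union bound over the avoided vertex).
survivors-bound : ∀ {n} f δ a → (∀ x → count (λ u → not (inBall f δ u x)) ≤ a) →
                  ∀ t → countSeqs t (continues f δ) ≤ n * a ^ t
survivors-bound {n} f δ a misses t = begin
  countSeqs t (continues f δ)                                  ≤⟨ countSeqs-mono t (running-avoided f δ) ⟩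
  countSeqs t (λ s → any (λ x → avoided f δ x s) (allFin n))   ≤⟨ countSeqs-any t (avoided f δ) (allFin n) ⟩
  Σᵥ (λ x → countSeqs t (avoided f δ x))                       ≤⟨ sum-map-mono avoid-x (allFin n) ⟩
  Σᵥ {n} (λ _ → a ^ t)                                         ≡⟨ Σᵥ-const n (a ^ t) ⟩
  n * a ^ t                                                    ∎
  where
  open ≤-Reasoning
  avoid-x : ∀ x → countSeqs t (avoided f δ x) ≤ a ^ t
  avoid-x x = ≤-trans (countSeqs-all t _) (^-monoˡ-≤ t (misses x))

module Balls {n : ℕ} (G : Graph n) (δ : Fin n → Fin n → ℕ) (sp : IsShortestPathMetric G δ) where
  open ShortestPath G δ sp

  ball : Fin n → ℕ → Fin n → Bool
  ball x r u = δ x u ≤ᵇ r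

  -- A ball of radius r < n contains at least r + 1 vertices: each radius
  -- up to r is realised by some vertex, unless the ball is everything.
  ball-size : ∀ x r → r < n → suc r ≤ count (ball x r)
  ball-size x zero _ =
    ≤-trans (s≤s z≤n) (count-strict {P = λ _ → false} (λ _ ()) x (λ ()) (≤⇒≤ᵇ (≤-reflexive (δ-self x))))
  ball-size x (suc r) r+1<n with sphere-or-all-closer x (suc r)
  ... | inj₁ (w , δxw≡r+1) = begin
    suc (suc r)               ≤⟨ s≤s (ball-size x r (<-trans (n<1+n r) r+1<n)) ⟩
    suc (count (ball x r))    ≤⟨ count-strict grow w outside-r inside-r+1 ⟩
    count (ball x (suc r))    ∎
    where
    open ≤-Reasoning
    grow : ∀ u → T (ball x r u) → T (ball x (suc r) u)
    grow u in-r = ≤⇒≤ᵇ (m≤n⇒m≤1+n (≤ᵇ⇒≤ (δ x u) r in-r))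
    outside-r : ¬ T (ball x r w)
    outside-r in-r = 1+n≰n (subst (_≤ r) δxw≡r+1 (≤ᵇ⇒≤ (δ x w) r in-r))
    inside-r+1 : T (ball x (suc r) w)
    inside-r+1 = ≤⇒≤ᵇ (≤-reflexive δxw≡r+1)
  ... | inj₂ all-closer =
    ≤-trans r+1<n (count-all (λ v → ≤⇒≤ᵇ (<⇒≤ (all-closer v))))

  -- If 2r < f, the ball of radius r around x lies in {u : x ∈ S_u}, so at most
  -- n − (r + 1) centres miss x.
  misses-bound : ∀ f r → 2 * r < f → r < n → ∀ x → count (λ u → not (inBall f δ u x)) ≤ n ∸ suc r
  misses-bound f r 2r<f r<n x = begin
    count (not ∘ covers)                         ≡⟨ m+n∸m≡n (count covers) _ ⟨
    count covers + count (not ∘ covers) ∸ count covers ≡⟨ cong (_∸ count covers) (count-complement covers) ⟩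
    n ∸ count covers                             ≤⟨ ∸-monoʳ-≤ n (≤-trans (ball-size x r r<n) (count-mono ball⊆covers)) ⟩
    n ∸ suc r                                    ∎
    where
    open ≤-Reasoning
    covers : Fin n → Bool
    covers u = inBall f δ u x
    ball⊆covers : ∀ u → T (ball x r u) → T (covers u)
    ball⊆covers u in-r =
      <⇒<ᵇ (≤-<-trans (*-monoʳ-≤ 2 (subst (_≤ r) (δ-sym x u) (≤ᵇ⇒≤ (δ x u) r in-r))) 2r<f)

bernoulli : ∀ a b L → a ^ L * (a + L * b) ≤ a * (a + b) ^ L
bernoulli a b zero    = ≤-reflexive (base a b)
  where
  base : ∀ a b → 1 * (a + 0 * b) ≡ a * 1
  base = solve-∀
bernoulli a b (suc L) = begin
  a * X * (a + suc L * b)           ≡⟨ split a b L X ⟩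
  X * (a + L * b) * a + a * X * b   ≤⟨ +-monoʳ-≤ (X * (a + L * b) * a) (*-monoˡ-≤ b aX≤) ⟩
  X * (a + L * b) * a + X * (a + L * b) * b ≡⟨ *-distribˡ-+ (X * (a + L * b)) a b ⟨
  X * (a + L * b) * (a + b)         ≤⟨ *-monoˡ-≤ (a + b) (bernoulli a b L) ⟩
  a * (a + b) ^ L * (a + b)         ≡⟨ regroup a (a + b) ((a + b) ^ L) ⟩
  a * ((a + b) * (a + b) ^ L)       ∎
  where
  open ≤-Reasoning
  X = a ^ L
  aX≤ : a * X ≤ X * (a + L * b)
  aX≤ = subst (_≤ X * (a + L * b)) (*-comm X a) (*-monoʳ-≤ X (m≤m+n a (L * b)))
  split : ∀ a b L X → a * X * (a + suc L * b) ≡ X * (a + L * b) * a + a * X * b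
  split = solve-∀
  regroup : ∀ a m Y → a * Y * m ≡ a * (m * Y)
  regroup = solve-∀

halving : ∀ a b L → 1 ≤ L → a ≤ L * b → 2 * a ^ L ≤ (a + b) ^ L
halving zero    b (suc L) _ _   = z≤n
halving (suc a) b L       _ a≤Lb = *-cancelʳ-≤ (2 * a' ^ L) ((a' + b) ^ L) a' (begin
  2 * a' ^ L * a'              ≡⟨ double a' (a' ^ L) ⟩
  a' ^ L * (a' + a')           ≤⟨ *-monoʳ-≤ (a' ^ L) (+-monoʳ-≤ a' a≤Lb) ⟩
  a' ^ L * (a' + L * b)        ≤⟨ bernoulli a' b L ⟩
  a' * (a' + b) ^ L            ≡⟨ *-comm a' ((a' + b) ^ L) ⟩
  (a' + b) ^ L * a'            ∎)
  where
  open ≤-Reasoning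
  a' = suc a
  double : ∀ a X → 2 * X * a ≡ X * (a + a)
  double = solve-∀

halving-iterate : ∀ x y J → 2 * x ≤ y → 2 ^ J * x ^ J ≤ y ^ J
halving-iterate x y zero    _    = ≤-refl
halving-iterate x y (suc J) 2x≤y = begin
  2 * 2 ^ J * (x * x ^ J)   ≡⟨ interchange 2 (2 ^ J) x (x ^ J) ⟩
  2 * x * (2 ^ J * x ^ J)   ≤⟨ *-mono-≤ 2x≤y (halving-iterate x y J 2x≤y) ⟩
  y * y ^ J                 ∎
  where
  open ≤-Reasoning
  interchange : ∀ p q r s → p * q * (r * s) ≡ p * r * (q * s)
  interchange = solve-∀

-- Escape time: for a + b = n with b ≥ 1 and n ≤ 2ᴶ, the time T = L·J with
-- L = ⌊a/b⌋ + 1 makes the survival bound n·(a/n)ᵀ at most 1, while b·T ≤ n·J.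
escape-time : ∀ a b n J → a + b ≡ n → 1 ≤ b → n ≤ 2 ^ J →
              ∃ λ T → n * a ^ T ≤ n ^ T × b * T ≤ n * J
escape-time a b n J a+b≡n b≥1 n≤2^J = L * J , escaped , short
  where
  open ≤-Reasoning
  instance
    b≢0 : NonZero b
    b≢0 = >-nonZero b≥1
  L = suc (a div b)
  a<Lb : a < L * b
  a<Lb = begin-strict
    a                       ≡⟨ m≡m%n+[m/n]*n a b ⟩
    a % b + a div b * b     <⟨ +-monoˡ-< (a div b * b) (m%n<n a b) ⟩
    L * b                   ∎
  Lb≤n : L * b ≤ n
  Lb≤n = begin
    b + a div b * b         ≤⟨ +-monoʳ-≤ b (m/n*n≤m a b) ⟩
    b + a                   ≡⟨ +-comm b a ⟩
    a + b                   ≡⟨ a+b≡n ⟩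
    n                       ∎
  half-survives : 2 * a ^ L ≤ n ^ L
  half-survives = subst (λ m → 2 * a ^ L ≤ m ^ L) a+b≡n (halving a b L (s≤s z≤n) (<⇒≤ a<Lb))
  escaped : n * a ^ (L * J) ≤ n ^ (L * J)
  escaped = begin
    n * a ^ (L * J)         ≤⟨ *-monoˡ-≤ (a ^ (L * J)) n≤2^J ⟩
    2 ^ J * a ^ (L * J)     ≡⟨ cong (2 ^ J *_) (^-*-assoc a L J) ⟨
    2 ^ J * (a ^ L) ^ J     ≤⟨ halving-iterate (a ^ L) (n ^ L) J half-survives ⟩
    (n ^ L) ^ J             ≡⟨ ^-*-assoc n L J ⟩
    n ^ (L * J)             ∎
  short : b * (L * J) ≤ n * J
  short = begin
    b * (L * J)             ≡⟨ *-assoc b L J ⟨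
    b * L * J               ≡⟨ cong (_* J) (*-comm b L) ⟩
    L * b * J               ≤⟨ *-monoˡ-≤ J Lb≤n ⟩
    n * J                   ∎

-- weighted n c k = Σ_{t<k} c(t)·n^{k−t}, i.e. nᵏ · Σ_{t<k} c(t)/nᵗ.
weighted : ℕ → (ℕ → ℕ) → ℕ → ℕ
weighted n c zero    = 0
weighted n c (suc k) = n * (weighted n c k + c k)

-- Geometric tail bound: if c(t) ≤ nᵗ always, c(t) ≤ n·aᵗ with a + b = n, and the
-- survival bound has escaped by time T (n·aᵀ ≤ nᵀ), then Σ_{t<k} c(t)/nᵗ ≤ T + n/b.
module GeometricTail (n a b : ℕ) (a+b≡n : a + b ≡ n) (c : ℕ → ℕ)
                     (c-total : ∀ t → c t ≤ n ^ t) (c-decay : ∀ t → c t ≤ n * a ^ t) where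
  W = weighted n c

  -- each term is at most 1
  weighted-trivial : ∀ k → W k ≤ k * n ^ k
  weighted-trivial zero    = z≤n
  weighted-trivial (suc k) = begin
    n * (W k + c k)               ≤⟨ *-monoʳ-≤ n (+-mono-≤ (weighted-trivial k) (c-total k)) ⟩
    n * (k * n ^ k + n ^ k)       ≡⟨ regroup n k (n ^ k) ⟩
    suc k * (n * n ^ k)           ∎
    where
    open ≤-Reasoning
    regroup : ∀ n k X → n * (k * X + X) ≡ suc k * (n * X)
    regroup = solve-∀

  -- the potential b·W + n²·aᵏ grows by a factor at most n per round
  potential-step : ∀ k → b * W (suc k) + n * n * a ^ suc k ≤ n * (b * W k + n * n * a ^ k)
  potential-step k = begin
    b * (n * (W k + c k)) + n * n * (a * a ^ k)      ≤⟨ +-monoˡ-≤ _ (*-monoʳ-≤ b (*-monoʳ-≤ n (+-monoʳ-≤ (W k) (c-decay k)))) ⟩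
    b * (n * (W k + n * a ^ k)) + n * n * (a * a ^ k) ≡⟨ absorb a+b≡n (W k) (a ^ k) ⟩
    n * (b * W k + n * n * a ^ k)                    ∎
    where
    open ≤-Reasoning
    absorb : ∀ {n} → a + b ≡ n → ∀ Y X → b * (n * (Y + n * X)) + n * n * (a * X) ≡ n * (b * Y + n * n * X)
    absorb refl = identity a b
      where
      identity : ∀ a b Y X → b * ((a + b) * (Y + (a + b) * X)) + (a + b) * (a + b) * (a * X)
                           ≡ (a + b) * (b * Y + (a + b) * (a + b) * X)
      identity = solve-∀

  potential-decay : ∀ T j → b * W (T + j) + n * n * a ^ (T + j) ≤ n ^ j * (b * W T + n * n * a ^ T)
  potential-decay T zero    rewrite +-identityʳ T = ≤-reflexive (sym (*-identityˡ _))
  potential-decay T (suc j) rewrite +-suc T j = begin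
    b * W (suc (T + j)) + n * n * a ^ suc (T + j)        ≤⟨ potential-step (T + j) ⟩
    n * (b * W (T + j) + n * n * a ^ (T + j))            ≤⟨ *-monoʳ-≤ n (potential-decay T j) ⟩
    n * (n ^ j * (b * W T + n * n * a ^ T))              ≡⟨ *-assoc n (n ^ j) _ ⟨
    n * n ^ j * (b * W T + n * n * a ^ T)                ∎
    where open ≤-Reasoning

  tail-bound : ∀ T → n * a ^ T ≤ n ^ T → ∀ k → b * W k ≤ (b * T + n) * n ^ k
  tail-bound T escaped k with ≤-total k T
  ... | inj₁ k≤T = begin
    b * W k                 ≤⟨ *-monoʳ-≤ b (weighted-trivial k) ⟩
    b * (k * n ^ k)         ≤⟨ *-monoʳ-≤ b (*-monoˡ-≤ (n ^ k) k≤T) ⟩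
    b * (T * n ^ k)         ≡⟨ *-assoc b T (n ^ k) ⟨
    b * T * n ^ k           ≤⟨ *-monoˡ-≤ (n ^ k) (m≤m+n (b * T) n) ⟩
    (b * T + n) * n ^ k     ∎
    where open ≤-Reasoning
  ... | inj₂ T≤k = subst (λ k → b * W k ≤ (b * T + n) * n ^ k) (m+[n∸m]≡n T≤k) (begin
    b * W (T + j)                                          ≤⟨ m≤m+n _ _ ⟩
    b * W (T + j) + n * n * a ^ (T + j)                    ≤⟨ potential-decay T j ⟩
    n ^ j * (b * W T + n * n * a ^ T)                      ≤⟨ *-monoʳ-≤ (n ^ j) (+-mono-≤ at-T at-escape) ⟩
    n ^ j * (b * T * n ^ T + n * n ^ T)                    ≡⟨ regroup (n ^ j) (b * T) n (n ^ T) ⟩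
    (b * T + n) * (n ^ T * n ^ j)                          ≡⟨ cong ((b * T + n) *_) (^-distribˡ-+-* n T j) ⟨
    (b * T + n) * n ^ (T + j)                              ∎)
    where
    open ≤-Reasoning
    j = k ∸ T
    at-T : b * W T ≤ b * T * n ^ T
    at-T = subst (b * W T ≤_) (sym (*-assoc b T (n ^ T))) (*-monoʳ-≤ b (weighted-trivial T))
    at-escape : n * n * a ^ T ≤ n * n ^ T
    at-escape = subst (_≤ n * n ^ T) (sym (*-assoc n n (a ^ T))) (*-monoʳ-≤ n escaped)
    regroup : ∀ P Q n X → P * (Q * X + n * X) ≡ (Q + n) * (X * P)
    regroup = solve-∀

-- Fractions of natural numbers, compared through unnormalised representatives.
fraction-view : ∀ x d → ℚ.toℚᵘ (+ x / suc d) ℚᵘ.≃ mkℚᵘ (+ x) d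
fraction-view x d = ℚP.toℚᵘ-fromℚᵘ (mkℚᵘ (+ x) d)

≤ᵘ-cross : ∀ {p q : ℚᵘ} X Y → ℚᵘ.↥ p ≡ + X → ℚᵘ.↥ q ≡ + Y →
           X * ℚᵘ.↧ₙ q ≤ Y * ℚᵘ.↧ₙ p → p ℚᵘ.≤ q
≤ᵘ-cross {p} {q} X Y ↥p ↥q X*Dq≤Y*Dp =
  ℚᵘ.*≤* (subst₂ ℤ._≤_ (as-product (ℚᵘ.↧ₙ q) ↥p) (as-product (ℚᵘ.↧ₙ p) ↥q) (ℤ.+≤+ X*Dq≤Y*Dp))
  where
  as-product : ∀ {r : ℤ} {Z} D → r ≡ + Z → + (Z * D) ≡ r ℤ.* + D
  as-product {Z = Z} D refl = ℤP.pos-* Z D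

fraction-≤ : ∀ x y D E .{{_ : NonZero D}} .{{_ : NonZero E}} → x * E ≤ y * D → + x / D ≤ℚ + y / E
fraction-≤ x y (suc d) (suc e) x*E≤y*D = ℚP.toℚᵘ-cancel-≤
  (ℚᵘP.≤-respˡ-≃ (ℚᵘP.≃-sym (fraction-view x d))
  (ℚᵘP.≤-respʳ-≃ (ℚᵘP.≃-sym (fraction-view y e)) (≤ᵘ-cross x y refl refl x*E≤y*D)))

fraction-step : ∀ (S : ℚ) x N c y D E .{{_ : NonZero D}} .{{_ : NonZero E}} →
                S ≤ℚ + x / D → (x + N * c) * E ≤ y * D →
                S ℚ.+ (+ N / 1) ℚ.* (+ c / D) ≤ℚ + y / E
fraction-step S x N c y (suc d) (suc e) S≤x/D next = ℚP.toℚᵘ-cancel-≤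
  (ℚᵘP.≤-respˡ-≃ (ℚᵘP.≃-sym (ℚP.toℚᵘ-homo-+ S _))
  (ℚᵘP.≤-respʳ-≃ (ℚᵘP.≃-sym (fraction-view y e))
  (ℚᵘP.≤-trans (ℚᵘP.+-monoʳ-≤ (ℚ.toℚᵘ S) (ℚᵘP.≤-reflexive increment-view))
  (ℚᵘP.≤-trans (ℚᵘP.+-monoˡ-≤ (mkℚᵘ (+ N) 0 ℚᵘ.* mkℚᵘ (+ c) d) S-view)
  (≤ᵘ-cross X y numerator refl cross)))))
  where
  D = suc d
  X = x * (1 * D) + N * c * D
  increment-view : ℚ.toℚᵘ ((+ N / 1) ℚ.* (+ c / D)) ℚᵘ.≃ mkℚᵘ (+ N) 0 ℚᵘ.* mkℚᵘ (+ c) d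
  increment-view = ℚᵘP.≃-trans (ℚP.toℚᵘ-homo-* (+ N / 1) (+ c / D))
                               (ℚᵘP.*-cong (fraction-view N 0) (fraction-view c d))
  S-view : ℚ.toℚᵘ S ℚᵘ.≤ mkℚᵘ (+ x) d
  S-view = ℚᵘP.≤-respʳ-≃ (fraction-view x d) (ℚP.toℚᵘ-mono-≤ S≤x/D)
  numerator : + x ℤ.* + (1 * D) ℤ.+ (+ N ℤ.* + c) ℤ.* + D ≡ + X
  numerator = sym (trans (ℤP.pos-+ (x * (1 * D)) (N * c * D))
    (cong₂ ℤ._+_ (ℤP.pos-* x (1 * D)) (trans (ℤP.pos-* (N * c) D) (cong (ℤ._* + D) (ℤP.pos-* N c)))))
  cross : X * suc e ≤ y * (D * (1 * D))
  cross = begin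
    X * suc e                     ≡⟨ expand x N c D (suc e) ⟩
    (x + N * c) * suc e * D       ≤⟨ *-monoˡ-≤ D next ⟩
    y * D * D                     ≡⟨ square y D ⟩
    y * (D * (1 * D))             ∎
    where
    open ≤-Reasoning
    expand : ∀ x N c D E → (x * (1 * D) + N * c * D) * E ≡ (x + N * c) * E * D
    expand = solve-∀
    square : ∀ y D → y * D * D ≡ y * (D * (1 * D))
    square = solve-∀

survivors : ∀ m → ℕ → (Fin (suc m) → Fin (suc m) → ℕ) → ℕ → ℕ
survivors m f δ t = countSeqs t (continues f δ)

expectation-as-weighted : ∀ m f δ k →
  partialExpectedQueries m f δ k
    ≤ℚ (+ (suc m * weighted (suc m) (survivors m f δ) k) / (suc m ^ k)) {{m^n≢0 (suc m) k}}
expectation-as-weighted m f δ zero    = fraction-≤ 0 (suc m * 0) 1 1 z≤n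
expectation-as-weighted m f δ (suc k) =
  fraction-step _ (n * W k) n (c k) (n * W (suc k)) (n ^ k) (n ^ suc k)
                {{m^n≢0 n k}} {{m^n≢0 n (suc k)}}
                (expectation-as-weighted m f δ k) (≤-reflexive (regroup n (W k) (c k) (n ^ k)))
  where
  n = suc m
  c = survivors m f δ
  W = weighted n c
  regroup : ∀ n w c X → (n * w + n * c) * (n * X) ≡ n * (n * (w + c)) * X
  regroup = solve-∀

-- The radius of the balls S_u = {v : δ(u,v) < p/2}: the r with 2r < p ≤ 2(r + 1).
radius : ∀ p .{{_ : NonZero p}} → ∃ λ r → 2 * r < p × p ≤ 2 * suc r
radius 1 = 0 , s≤s z≤n , s≤s z≤n
radius 2 = 0 , s≤s z≤n , ≤-refl
radius (suc (suc (suc q))) with radius (suc q)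
... | r , 2r<p , p≤2r+2 = suc r , subst (_< 3 + q) (sym (double-suc r)) (s≤s (s≤s 2r<p))
                                , subst (3 + q ≤_) (sym (double-suc (suc r))) (s≤s (s≤s p≤2r+2))
  where
  double-suc : ∀ r → 2 * suc r ≡ 2 + 2 * r
  double-suc = solve-∀

log-bound : ∀ n → n ≤ 2 ^ suc ⌊log₂ n ⌋
log-bound n = ≮⇒≥ λ 2^J<n → 1+n≰n (begin
  suc ⌊log₂ n ⌋              ≡⟨ ⌊log₂[2^n]⌋≡n (suc ⌊log₂ n ⌋) ⟨
  ⌊log₂ 2 ^ suc ⌊log₂ n ⌋ ⌋  ≤⟨ ⌊log₂⌋-mono-≤ (<⇒≤ 2^J<n) ⟩
  ⌊log₂ n ⌋                  ∎)
  where open ≤-Reasoning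

log-positive : ∀ n → 2 ≤ n → 1 ≤ ⌊log₂ n ⌋
log-positive n n≥2 = subst (_≤ ⌊log₂ n ⌋) (⌊log₂[2^n]⌋≡n 1) (⌊log₂⌋-mono-≤ n≥2)

module QueryBound (m : ℕ) (G : Graph (suc m)) (δ : Fin (suc m) → Fin (suc m) → ℕ)
                  (sp : IsShortestPathMetric G δ) (p : ℕ) .{{_ : NonZero p}}
                  (r : ℕ) (2r<p : 2 * r < p) (p≤2r+2 : p ≤ 2 * suc r)
                  (p≤n : p ≤ suc m) (n≥2 : 2 ≤ suc m) where
  n  = suc m
  lg = ⌊log₂ n ⌋
  b  = suc r
  a  = n ∸ b
  c  = survivors m p δ

  b≤n : b ≤ n
  b≤n = <-≤-trans (≤-<-trans (m≤m+n r (r + 0)) 2r<p) p≤n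

  escape : ∃ λ T → n * a ^ T ≤ n ^ T × b * T ≤ n * suc lg
  escape = escape-time a b n (suc lg) (m∸n+n≡m b≤n) (s≤s z≤n) (log-bound n)

  τ = proj₁ escape

  open GeometricTail n a b (m∸n+n≡m b≤n) c (λ t → countSeqs-total t _)
         (survivors-bound p δ a (Balls.misses-bound G δ sp p r 2r<p b≤n))

  lg+2≤3lg : lg + 2 ≤ 3 * lg
  lg+2≤3lg = subst (lg + 2 ≤_) (three lg) (+-monoʳ-≤ lg (*-monoʳ-≤ 2 (log-positive n n≥2)))
    where
    three : ∀ l → l + 2 * l ≡ 3 * l
    three = solve-∀

  cross : ∀ k → n * W k * p ≤ 6 * (n * n) * lg * n ^ k
  cross k = begin
    n * W k * p                        ≤⟨ *-monoʳ-≤ (n * W k) p≤2r+2 ⟩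
    n * W k * (2 * b)                  ≡⟨ regroup₁ n (W k) b ⟩
    2 * n * (b * W k)                  ≤⟨ *-monoʳ-≤ (2 * n) (tail-bound τ (proj₁ (proj₂ escape)) k) ⟩
    2 * n * ((b * τ + n) * n ^ k)      ≤⟨ *-monoʳ-≤ (2 * n) (*-monoˡ-≤ (n ^ k) (+-monoˡ-≤ n (proj₂ (proj₂ escape)))) ⟩
    2 * n * ((n * suc lg + n) * n ^ k) ≡⟨ regroup₂ n lg (n ^ k) ⟩
    2 * (n * n) * (lg + 2) * n ^ k     ≤⟨ *-monoˡ-≤ (n ^ k) (*-monoʳ-≤ (2 * (n * n)) lg+2≤3lg) ⟩
    2 * (n * n) * (3 * lg) * n ^ k     ≡⟨ regroup₃ (n * n) lg (n ^ k) ⟩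
    6 * (n * n) * lg * n ^ k           ∎
    where
    open ≤-Reasoning
    regroup₁ : ∀ n w b → n * w * (2 * b) ≡ 2 * n * (b * w)
    regroup₁ = solve-∀
    regroup₂ : ∀ n l X → 2 * n * ((n * suc l + n) * X) ≡ 2 * (n * n) * (l + 2) * X
    regroup₂ = solve-∀
    regroup₃ : ∀ N l X → 2 * N * (3 * l) * X ≡ 6 * N * l * X
    regroup₃ = solve-∀

  bound : ∀ k → partialExpectedQueries m p δ k ≤ℚ + (6 * (n * n) * lg) / p
  bound k = ℚP.≤-trans (expectation-as-weighted m p δ k)
                       (fraction-≤ (n * W k) (6 * (n * n) * lg) (n ^ k) p {{m^n≢0 n k}} (cross k))

theorem3 : (f : ℕ → ℕ) → Sublinear f → (fnz : ∀ n → NonZero (f n)) →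
    ((m : ℕ) (G : Graph (suc m)) (δ : Fin (suc m) → Fin (suc m) → ℕ) →
      Connected G → IsShortestPathMetric G δ →
      (s : List (Fin (suc m))) → Stops (f (suc m)) δ s →
      IsApprox (f (suc m)) δ (run (f (suc m)) δ s))
    ×
    (∃ λ C → ∃ λ N → (m : ℕ) → N ≤ suc m →
      (G : Graph (suc m)) (δ : Fin (suc m) → Fin (suc m) → ℕ) →
      Connected G → IsShortestPathMetric G δ →
      (k : ℕ) →
      partialExpectedQueries m (f (suc m)) δ k
        ≤ℚ _/_ (+ (C * (suc m * suc m) * ⌊log₂ suc m ⌋)) (f (suc m)) {{fnz (suc m)}})
theorem3 f sublinear fnz = correct , 6 , N + 2 , efficient
  where
  -- from n ≥ N on, f(n) ≤ n
  N = proj₁ (sublinear 0)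

  correct : ∀ m G δ → Connected G → IsShortestPathMetric G δ → ∀ s → Stops (f (suc m)) δ s →
            IsApprox (f (suc m)) δ (run (f (suc m)) δ s)
  correct m G δ _ sp s (done , _) =
    approximation-correct G δ sp (f (suc m)) (>-nonZero⁻¹ (f (suc m)) {{fnz (suc m)}}) s (subst T (sym done) tt)

  efficient : ∀ m → N + 2 ≤ suc m → ∀ G δ → Connected G → IsShortestPathMetric G δ → ∀ k →
              partialExpectedQueries m (f (suc m)) δ k
                ≤ℚ _/_ (+ (6 * (suc m * suc m) * ⌊log₂ suc m ⌋)) (f (suc m)) {{fnz (suc m)}}
  efficient m N+2≤n G δ _ sp k =
    QueryBound.bound m G δ sp p {{fnz (suc m)}} r 2r<p p≤2r+2 p≤n (≤-trans (m≤n+m 2 N) N+2≤n) k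
    where
    p = f (suc m)
    p≤n : p ≤ suc m
    p≤n = subst (_≤ suc m) (*-identityˡ p) (proj₂ (sublinear 0) (suc m) (≤-trans (m≤m+n N 2) N+2≤n))
    r = proj₁ (radius p {{fnz (suc m)}})
    2r<p = proj₁ (proj₂ (radius p {{fnz (suc m)}}))
    p≤2r+2 = proj₂ (proj₂ (radius p {{fnz (suc m)}}))
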